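{- Let $A=(1,4,9,\dots)$ be the sequence of perfect squares, $a_j=j^2$. For all integers $n\ge 1$ and all odd integers $k$ with $1\le k\le n$, we have $A^\varphi(n,k)\le 2k^2+14k+40$.
   Context: $\varphi$ denotes Euler's totient function. For a sequence $A=(a_1,a_2,\dots)$ of positive integers and an integer $n\ge 1$, the partial evaluations $A^\varphi(n,k)$ for $0\le k\le n$ are defined recursively by $A^\varphi(n,n)=0$ and $A^\varphi(n,k-1)=\varphi\big(a_k+A^\varphi(n,k)\big)$ for $1\le k\le n$. -}

module Defs where

open import Data.Nat using (ℕ; zero; suc; _+_; _*_; _∸_; _≟_)
open import Data.Nat.GCD using (gcd)
open import Data.List using (List; length; filter; upTo; map)
open import Relation.Nullary.Decidable using (⌊_⌋)

φ : ℕ → ℕ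
φ n = length (filter (λ i → gcd i n ≟ 1) (map suc (upTo n)))

-- Sequence A = (a_1, a_2, ...) given as a function ℕ → ℕ with a j = a_j (j ≥ 1).
-- evalFrom a m k = A^φ(k + m, k): the partial evaluation at index k when
-- m steps remain to reach n = k + m.
evalFrom : (ℕ → ℕ) → ℕ → ℕ → ℕ
evalFrom a zero    k = 0
evalFrom a (suc m) k = φ (a (suc k) + evalFrom a m (suc k))

-- A^φ(n,k) for 0 ≤ k ≤ n:  A^φ(n,n) = 0,  A^φ(n,k-1) = φ(a_k + A^φ(n,k)).
Aφ : (ℕ → ℕ) → ℕ → ℕ → ℕ
Aφ a n k = evalFrom a (n ∸ k) k

squares : ℕ → ℕ
squares j = j * j

-- For odd k, both (k + 1)² and A(n, k + 1) are even: the latter is 0 or φ of a number ≥ 3, and φ(m)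
-- is even for m ≥ 3 because i ↦ m − i pairs off the residues coprime to m. Since φ(2q) ≤ q, the
-- totient at least halves the even number (k + 1)² + A(n, k + 1) ≤ (k + 1)² + (k + 2)² + A(n, k + 2),
-- so induction downwards over odd k closes for B(k) = 2k² + 14k + 40, which satisfies
-- (k + 1)² + (k + 2)² + B(k + 2) = 2 B(k) + 1.
module Submission where

open import Defs
open import Data.Nat using (ℕ; zero; suc; _+_; _*_; _≤_; _<_; _%_; _/_; _∸_; _≟_; z≤n; s≤s)
open import Data.Nat.Properties
open import Data.Nat.Divisibility using (_∣_; divides; ∣-refl; _∣0; ∣m∣n⇒∣m+n; ∣m+n∣m⇒∣n; ∣m⇒∣m*n; m∣m*n; n∣m*n)
open import Data.Nat.DivMod using (m≡m%n+[m/n]*n)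
open import Data.Nat.GCD using (gcd)
open import Data.Nat.Coprimality using (gcd≡1⇒coprime; coprime⇒gcd≡1)
open import Data.Nat.Tactic.RingSolver using (solve-∀)
open import Data.List using (length; filter; applyUpTo)
open import Data.List.Properties using (map-upTo)
open import Data.Product using (_,_)
open import Data.Bool using (true; false)
open import Function using (_∘_; _⇔_; mk⇔; Equivalence)
open import Level using (Level)
open import Relation.Nullary using (Dec; _because_; yes; no; ¬_; contradiction)
open import Relation.Unary using (Pred; Decidable)
open import Relation.Binary.PropositionalEquality
  using (_≡_; _≢_; refl; sym; trans; cong; subst; module ≡-Reasoning)

private
  variable
    a p : Level
    A : Set a
    P : Pred ℕ p

indicator : Dec A → ℕ
indicator (true  because _) = 1
indicator (false because _) = 0

indicator≤1 : (a? : Dec A) → indicator a? ≤ 1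
indicator≤1 (true  because _) = ≤-refl
indicator≤1 (false because _) = z≤n

indicator-no : (a? : Dec A) → ¬ A → indicator a? ≡ 0
indicator-no (yes a) ¬a = contradiction a ¬a
indicator-no (no _)  _  = refl

indicator-⇔ : {B : Set p} → A ⇔ B → (a? : Dec A) (b? : Dec B) → indicator a? ≡ indicator b?
indicator-⇔ _   (yes _) (yes _) = refl
indicator-⇔ _   (no _)  (no _)  = refl
indicator-⇔ A⇔B (yes a) (no ¬b) = contradiction (Equivalence.to A⇔B a) ¬b
indicator-⇔ A⇔B (no ¬a) (yes b) = contradiction (Equivalence.from A⇔B b) ¬a

count : Decidable P → ℕ → ℕ
count P? zero    = 0
count P? (suc n) = indicator (P? 0) + count (P? ∘ suc) n

count≤n : (P? : Decidable P) (n : ℕ) → count P? n ≤ n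
count≤n P? zero    = z≤n
count≤n P? (suc n) = +-mono-≤ (indicator≤1 (P? 0)) (count≤n (P? ∘ suc) n)

count-snoc : (P? : Decidable P) (n : ℕ) → count P? (suc n) ≡ count P? n + indicator (P? n)
count-snoc P? zero    = +-comm (indicator (P? 0)) 0
count-snoc P? (suc n) = begin
  indicator (P? 0) + count (P? ∘ suc) (suc n)                    ≡⟨ cong (indicator (P? 0) +_) (count-snoc (P? ∘ suc) n) ⟩
  indicator (P? 0) + (count (P? ∘ suc) n + indicator (P? (suc n))) ≡⟨ +-assoc (indicator (P? 0)) _ _ ⟨
  count P? (suc n) + indicator (P? (suc n))                        ∎
  where open ≡-Reasoning

length-filter-applyUpTo : (P? : Decidable P) (f : ℕ → ℕ) (n : ℕ) →
                          length (filter P? (applyUpTo f n)) ≡ count (P? ∘ f) n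
length-filter-applyUpTo P? f zero = refl
length-filter-applyUpTo P? f (suc n) with P? (f 0)
... | yes _ = cong suc (length-filter-applyUpTo P? (f ∘ suc) n)
... | no  _ = length-filter-applyUpTo P? (f ∘ suc) n

count-even : (P? : Decidable P) (n : ℕ) →
             (∀ i j → suc (i + j) ≡ n → P i → P j) →
             (∀ i → suc (i + i) ≡ n → ¬ P i) →
             2 ∣ count P? n
count-even P? zero          _      _      = 2 ∣0
count-even P? (suc zero)    _      centre rewrite indicator-no (P? 0) (centre 0 refl) = 2 ∣0
count-even P? (suc (suc n)) mirror centre =
  subst (2 ∣_) (sym count≡) (∣m∣n⇒∣m+n inner (m∣m*n x))
  where
  open ≡-Reasoning
  shift : ∀ {i j} → suc (i + j) ≡ n → suc (suc i + suc j) ≡ suc (suc n)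
  shift {i} {j} e = cong (suc ∘ suc) (trans (+-suc i j) e)
  inner : 2 ∣ count (P? ∘ suc) n
  inner = count-even (P? ∘ suc) n (λ i j → mirror (suc i) (suc j) ∘ shift) (λ i → centre (suc i) ∘ shift)
  x : ℕ
  x = indicator (P? 0)
  ends : x ≡ indicator (P? (suc n))
  ends = indicator-⇔ (mk⇔ (mirror 0 (suc n) refl) (mirror (suc n) 0 (cong (suc ∘ suc) (+-identityʳ n))))
                     (P? 0) (P? (suc n))
  rearrange : ∀ x c → x + (c + x) ≡ c + 2 * x
  rearrange = solve-∀
  count≡ : count P? (suc (suc n)) ≡ count (P? ∘ suc) n + 2 * x
  count≡ = begin
    x + count (P? ∘ suc) (suc n)                      ≡⟨ cong (x +_) (count-snoc (P? ∘ suc) n) ⟩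
    x + (count (P? ∘ suc) n + indicator (P? (suc n))) ≡⟨ cong (λ y → x + (count (P? ∘ suc) n + y)) ends ⟨
    x + (count (P? ∘ suc) n + x)                      ≡⟨ rearrange x (count (P? ∘ suc) n) ⟩
    count (P? ∘ suc) n + 2 * x                        ∎

count≤half : (P? : Decidable P) (q : ℕ) → (∀ i → ¬ P (suc (i * 2))) → count P? (q * 2) ≤ q
count≤half P? zero    _   = z≤n
count≤half P? (suc q) odd rewrite indicator-no (P? 1) (odd 0) =
  +-mono-≤ (indicator≤1 (P? 0)) (count≤half (P? ∘ suc ∘ suc) q (odd ∘ suc))

gcd[m,n]≢1 : ∀ {d} m n → d ≢ 1 → d ∣ m → d ∣ n → gcd m n ≢ 1
gcd[m,n]≢1 _ _ d≢1 d∣m d∣n g≡1 = d≢1 (gcd≡1⇒coprime g≡1 (d∣m , d∣n))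

gcd≡1-complement : ∀ m k {n} → m + k ≡ n → gcd m n ≡ 1 → gcd k n ≡ 1
gcd≡1-complement m k m+k≡n g≡1 = coprime⇒gcd≡1 λ (d∣k , d∣n) →
  gcd≡1⇒coprime {m} g≡1 (∣m+n∣m⇒∣n (subst (_ ∣_) (trans (sym m+k≡n) (+-comm m k)) d∣n) d∣k , d∣n)

coprimeTo? : (n : ℕ) → Decidable (λ i → gcd (suc i) n ≡ 1)
coprimeTo? n i = gcd (suc i) n ≟ 1

φ≡count : ∀ n → φ n ≡ count (coprimeTo? n) n
φ≡count n = trans (cong (length ∘ filter (λ i → gcd i n ≟ 1)) (map-upTo suc n))
                  (length-filter-applyUpTo (λ i → gcd i n ≟ 1) suc n)

φ≤n : ∀ n → φ n ≤ n
φ≤n n = subst (_≤ n) (sym (φ≡count n)) (count≤n (coprimeTo? n) n)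

φ-half : ∀ {n} → 2 ∣ n → 2 * φ n ≤ n
φ-half (divides q refl) = begin
  2 * φ (q * 2)                          ≡⟨ cong (2 *_) (φ≡count (q * 2)) ⟩
  2 * count (coprimeTo? (q * 2)) (q * 2) ≤⟨ *-monoʳ-≤ 2 (count≤half (coprimeTo? (q * 2)) q even-not-coprime) ⟩
  2 * q                                  ≡⟨ *-comm 2 q ⟩
  q * 2                                  ∎
  where
  open ≤-Reasoning
  even-not-coprime : ∀ i → gcd (suc i * 2) (q * 2) ≢ 1
  even-not-coprime i = gcd[m,n]≢1 (suc i * 2) (q * 2) (λ ()) (n∣m*n (suc i)) (n∣m*n q)

φ-even : ∀ {n} → 2 < n → 2 ∣ φ n
φ-even {suc l} (s≤s 2≤l) = subst (2 ∣_) (sym φ≡) (count-even P? l mirror centre)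
  where
  open ≡-Reasoning
  P? : Decidable (λ i → gcd (suc i) (suc l) ≡ 1)
  P? = coprimeTo? (suc l)
  φ≡ : φ (suc l) ≡ count P? l
  φ≡ = begin
    φ (suc l)                     ≡⟨ φ≡count (suc l) ⟩
    count P? (suc l)              ≡⟨ count-snoc P? l ⟩
    count P? l + indicator (P? l) ≡⟨ cong (count P? l +_) (indicator-no (P? l) (gcd[m,n]≢1 (suc l) (suc l) 1+l≢1 ∣-refl ∣-refl)) ⟩
    count P? l + 0                ≡⟨ +-identityʳ _ ⟩
    count P? l                    ∎
    where
    1+l≢1 : suc l ≢ 1
    1+l≢1 = >⇒≢ (m≤n⇒m≤1+n 2≤l)
  mirror : ∀ i j → suc (i + j) ≡ l → gcd (suc i) (suc l) ≡ 1 → gcd (suc j) (suc l) ≡ 1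
  mirror i j e = gcd≡1-complement (suc i) (suc j) (cong suc (trans (+-suc i j) e))
  centre : ∀ i → suc (i + i) ≡ l → gcd (suc i) (suc l) ≢ 1
  centre zero    e _ = <⇒≢ 2≤l e
  centre (suc i) e   = gcd[m,n]≢1 (2 + i) (suc l) (λ ()) ∣-refl (subst (2 + i ∣_) 2+i+2+i≡1+l (∣m∣n⇒∣m+n ∣-refl ∣-refl))
    where
    2+i+2+i≡1+l : (2 + i) + (2 + i) ≡ suc l
    2+i+2+i≡1+l = cong suc (trans (cong suc (+-suc i (suc i))) e)

evalFrom-even : (a : ℕ → ℕ) (m k : ℕ) → 2 < a (suc k) → 2 ∣ evalFrom a m k
evalFrom-even a zero    k _   = 2 ∣0
evalFrom-even a (suc m) k 2<a = φ-even (<-≤-trans 2<a (m≤m+n (a (suc k)) _))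

2*m≤1+2*n⇒m≤n : ∀ {m n} → 2 * m ≤ suc (2 * n) → m ≤ n
2*m≤1+2*n⇒m≤n {m} {n} h = ≤-pred (*-cancelˡ-< 2 m (suc n) (subst (2 * m <_) (sym (*-suc 2 n)) (s≤s h)))

bound : ℕ → ℕ
bound k = 2 * (k * k) + 14 * k + 40

bound-step : ∀ k → squares (1 + k) + (squares (2 + k) + bound (2 + k)) ≡ suc (2 * bound k)
bound-step = polynomial
  where
  polynomial : ∀ k → (1 + k) * (1 + k) + ((2 + k) * (2 + k) + (2 * ((2 + k) * (2 + k)) + 14 * (2 + k) + 40))
                     ≡ suc (2 * (2 * (k * k) + 14 * k + 40))
  polynomial = solve-∀

evalFrom-squares≤bound : ∀ m k → 2 ∣ suc k → evalFrom squares m k ≤ bound k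
evalFrom-squares≤bound zero    k _     = z≤n
evalFrom-squares≤bound (suc m) k 2∣1+k = 2*m≤1+2*n⇒m≤n (begin
  2 * φ (squares (1 + k) + evalFrom squares m (1 + k)) ≤⟨ φ-half (∣m∣n⇒∣m+n (∣m⇒∣m*n (1 + k) 2∣1+k) next-even) ⟩
  squares (1 + k) + evalFrom squares m (1 + k)         ≤⟨ +-monoʳ-≤ (squares (1 + k)) (next≤ m) ⟩
  squares (1 + k) + (squares (2 + k) + bound (2 + k))  ≡⟨ bound-step k ⟩
  suc (2 * bound k)                                    ∎)
  where
  open ≤-Reasoning
  next-even : 2 ∣ evalFrom squares m (1 + k)
  next-even = evalFrom-even squares m (1 + k) (<⇒≤ (*-mono-≤ (m≤m+n 2 k) (m≤m+n 2 k)))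
  next≤ : ∀ m → evalFrom squares m (1 + k) ≤ squares (2 + k) + bound (2 + k)
  next≤ zero    = z≤n
  next≤ (suc m) = ≤-trans (φ≤n _) (+-monoʳ-≤ (squares (2 + k)) (evalFrom-squares≤bound m (2 + k) 2∣3+k))
    where
    2∣3+k : 2 ∣ 3 + k
    2∣3+k = ∣m∣n⇒∣m+n ∣-refl 2∣1+k

odd⇒2∣suc : ∀ k → k % 2 ≡ 1 → 2 ∣ suc k
odd⇒2∣suc k k%2≡1 = divides (suc (k / 2)) (cong suc (trans (m≡m%n+[m/n]*n k 2) (cong (_+ k / 2 * 2) k%2≡1)))

-- The bound holds for any number n ∸ k of remaining steps.
lemma4p1 : (n k : ℕ) → 1 ≤ n → 1 ≤ k → k ≤ n → k % 2 ≡ 1 →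
    Aφ squares n k ≤ 2 * (k * k) + 14 * k + 40
lemma4p1 n k _ _ _ k%2≡1 = evalFrom-squares≤bound (n ∸ k) k (odd⇒2∣suc k k%2≡1)
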